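{- Let $p\ge 7$ be a prime. Then $$\sum_{k=1}^{p-1}\frac{H_k^2}{k^2}\equiv 0\pmod{p},\qquad \sum_{k=1}^{p-1}\frac{H_k\, H_{k,2}}{k}\equiv 0\pmod{p},\qquad \sum_{k=1}^{p-1}\frac{H_k^3}{k}\equiv 0\pmod{p}.$$
   Context: $H_{n,m}=\sum_{k=1}^{n}\frac{1}{k^m}$ and $H_n=H_{n,1}$. Congruences modulo $p$ are taken in the ring of rational numbers with denominators not divisible by $p$. -}

module Defs where

open import Data.Nat as ℕ using (ℕ; zero; suc; _^_)
open import Data.Nat.Properties using (m^n≢0)
open import Data.Nat.Divisibility using (_∣_)
open import Data.Integer as ℤ using (ℤ; +_)
open import Data.Rational using (ℚ; _/_; _+_; _*_; 0ℚ; ↥_; ↧ₙ_)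
open import Relation.Nullary using (¬_)
open import Data.Product using (_×_)

inv-pow : ℕ → ℕ → ℚ
inv-pow i m = (+ 1) / (suc i ^ m)
  where instance _ = m^n≢0 (suc i) m

H : ℕ → ℕ → ℚ
H zero    m = 0ℚ
H (suc n) m = H n m + inv-pow n m

sum1to : ℕ → (ℕ → ℚ) → ℚ
sum1to zero    f = 0ℚ
sum1to (suc n) f = sum1to n f + f (suc n)

-- 1/k^m for k ≥ 1 given as a natural (k = 0 yields 1, never used)
recip^ : ℕ → ℕ → ℚ
recip^ zero    m = (+ 1) / 1
recip^ (suc i) m = inv-pow i m

-- q ≡ 0 (mod p) in the ring of rationals with denominator prime to p:
-- (reduced) denominator not divisible by p and numerator divisible by p.
_≡0mod_ : ℚ → ℕ → Set
q ≡0mod p = ¬ (p ∣ ↧ₙ q) × (p ∣ ℤ.∣ ↥ q ∣)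

module Submission where

-- Write β n k = (-1)^(k-1) C(n,k) and T n f = Σ_{k=1}^{n} β n k f(k) for the binomial
-- transform.  Absorption k C(n,k) = n C(n-1,k-1) makes T turn division by k into summation,
-- T n (f/k) = Σ_{m ≤ n} T m f / m, from which T sends 1/k^j to the star sum H⋆_j, H_{k,2} to
-- H_n/n and H_k^2 to (2/n - H_n)/n.  For n = p - 1 every β n k ≡ -1 (mod p), so T (p-1) f ≡
-- -Σ f for p-integral f.  Applied to 1/k^j this gives H⋆_j ≡ -H_{p-1,j}, and Newton's identities
-- between star sums and power sums then force H_{p-1,j} ≡ 0 for j ≤ 4 once 2, 3, 5 are
-- invertible.  Applied to H_{k,2}/k^2 and H_k^2/k^2 (followed by summation by parts) it gives
-- Σ H_k^2/k^2 ≡ Σ H_k/k^3 ≡ 0; the other two sums follow from the expansions of H^2 H_{·,2}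
-- and H^4 as sums of their increments.

open import Defs
open import Agda.Builtin.FromNat using (Number; fromNat)
open import Agda.Builtin.FromNeg using (Negative; fromNeg)
open import Data.Nat as ℕ using (ℕ; zero; suc; _<_; _≤_; _≥_; _∸_; s≤s; z≤n)
import Data.Nat.Properties as ℕ
import Data.Nat.Literals as ℕ
open import Data.Nat.Divisibility as ℕ using (_∤_)
open import Data.Nat.Primality using (Prime; euclidsLemma; prime⇒nonTrivial)
import Data.Nat.Coprimality as Cop
open import Data.Integer as ℤ using (+_)
import Data.Integer.Properties as ℤ
import Data.Integer.Divisibility.Signed as ℤ
import Data.Integer.Tactic.RingSolver as ℤ
open import Data.Rational as ℚ using (ℚ; 0ℚ; 1ℚ; _+_; _*_; -_; _-_; toℚᵘ)
import Data.Rational.Properties as ℚ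
import Data.Rational.Literals as ℚLiteral
open import Data.Rational.Unnormalised as ℚᵘ using (mkℚᵘ; *≡*)
import Data.Rational.Unnormalised.Properties as ℚᵘ
open import Data.Maybe using (Maybe; just; nothing)
open import Data.Product using (_×_; _,_; ∃-syntax)
open import Data.Sum using (inj₁; inj₂)
open import Data.Unit using (tt)
open import Level using (0ℓ)
open import Relation.Nullary using (yes; no; contradiction)
open import Relation.Binary.PropositionalEquality
open import Tactic.RingSolver using (solve-∀)
import Tactic.RingSolver.Core.AlmostCommutativeRing as ACR

ℚ-ring : ACR.AlmostCommutativeRing 0ℓ 0ℓ
ℚ-ring = ACR.fromCommutativeRing ℚ.+-*-commutativeRing 0≟
  where
  0≟ : ∀ x → Maybe (0ℚ ≡ x)
  0≟ x with 0ℚ ℚ.≟ x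
  ... | yes 0≡x = just 0≡x
  ... | no _    = nothing

instance
  ℕ-number : Number ℕ
  ℕ-number = ℕ.number
  ℚ-number : Number ℚ
  ℚ-number = ℚLiteral.number
  ℚ-negative : Negative ℚ
  ℚ-negative = ℚLiteral.negative

-- x ^ 1 reduces to x and x ^ (2 + j) to x ^ (1 + j) * x.
open ACR.AlmostCommutativeRing ℚ-ring using (_^_)

neg-involutive : ∀ x → - - x ≡ x
neg-involutive = solve-∀ ℚ-ring

fromℕ : ℕ → ℚ
fromℕ zero    = 0ℚ
fromℕ (suc n) = 1ℚ + fromℕ n

inv : ℕ → ℚ
inv k = recip^ k 1

toℚᵘ-fromℕ : ∀ n → toℚᵘ (fromℕ n) ℚᵘ.≃ mkℚᵘ (+ n) 0
toℚᵘ-fromℕ zero    = *≡* refl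
toℚᵘ-fromℕ (suc n) = ℚᵘ.≃-trans (ℚ.toℚᵘ-homo-+ 1ℚ (fromℕ n))
  (ℚᵘ.≃-trans (ℚᵘ.+-congʳ (toℚᵘ 1ℚ) (toℚᵘ-fromℕ n)) (*≡* (1+N (+ n))))
  where
  1+N : ∀ N → (+ 1 ℤ.* + 1 ℤ.+ N ℤ.* + 1) ℤ.* + 1 ≡ (+ 1 ℤ.+ N) ℤ.* (+ 1 ℤ.* + 1)
  1+N = ℤ.solve-∀

toℚᵘ-recip^ : ∀ k m → toℚᵘ (recip^ (suc k) m) ℚᵘ.≃ mkℚᵘ (+ 1) (ℕ.pred (suc k ℕ.^ m))
toℚᵘ-recip^ k m = 1/d (suc k ℕ.^ m) {{ℕ.m^n≢0 (suc k) m}}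
  where
  1/d : ∀ d .{{_ : ℕ.NonZero d}} → toℚᵘ ((+ 1) ℚ./ d) ℚᵘ.≃ mkℚᵘ (+ 1) (ℕ.pred d)
  1/d (suc d) = ℚᵘ.≃-reflexive (cong toℚᵘ (ℚ.normalize-coprime (Cop.1-coprimeTo (suc d))))

fromℕ*inv≡1 : ∀ k → fromℕ (suc k) * inv (suc k) ≡ 1ℚ
fromℕ*inv≡1 k = ℚ.toℚᵘ-injective (begin
  toℚᵘ (fromℕ (suc k) * inv (suc k))            ≈⟨ ℚ.toℚᵘ-homo-* (fromℕ (suc k)) (inv (suc k)) ⟩
  toℚᵘ (fromℕ (suc k)) ℚᵘ.* toℚᵘ (inv (suc k))  ≈⟨ ℚᵘ.*-cong (toℚᵘ-fromℕ (suc k)) (toℚᵘ-recip^ k 1) ⟩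
  K ℚᵘ.* mkℚᵘ (+ 1) (ℕ.pred (suc k ℕ.* 1))
    ≈⟨ ℚᵘ.≃-reflexive (cong (λ d → K ℚᵘ.* mkℚᵘ (+ 1) d) (ℕ.*-identityʳ k)) ⟩
  K ℚᵘ.* mkℚᵘ (+ 1) k                            ≈⟨ *≡* (K*1≡1*K (+ suc k)) ⟩
  toℚᵘ 1ℚ                                        ∎)
  where
  open ℚᵘ.≃-Reasoning
  K = mkℚᵘ (+ suc k) 0
  K*1≡1*K : ∀ K → K ℤ.* + 1 ℤ.* + 1 ≡ + 1 ℤ.* (+ 1 ℤ.* K)
  K*1≡1*K = ℤ.solve-∀

recip^-suc : ∀ k m → recip^ (suc k) (suc m) ≡ recip^ (suc k) m * inv (suc k)
recip^-suc k m = ℚ.toℚᵘ-injective (begin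
  toℚᵘ (recip^ (suc k) (suc m))        ≈⟨ toℚᵘ-recip^ k (suc m) ⟩
  1/ (s ℕ.^ suc m)                     ≈⟨ ℚᵘ.≃-reflexive (cong 1/_ s^[1+m]≡s^m*s) ⟩
  1/ (s ℕ.^ m ℕ.* s ℕ.^ 1)             ≈⟨ 1/x*1/y (s ℕ.^ m) (s ℕ.^ 1) {{ℕ.m^n≢0 s m}} {{ℕ.m^n≢0 s 1}} ⟨
  1/ (s ℕ.^ m) ℚᵘ.* 1/ (s ℕ.^ 1)       ≈⟨ ℚᵘ.*-cong (toℚᵘ-recip^ k m) (toℚᵘ-recip^ k 1) ⟨
  toℚᵘ (recip^ s m) ℚᵘ.* toℚᵘ (inv s)  ≈⟨ ℚ.toℚᵘ-homo-* (recip^ s m) (inv s) ⟨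
  toℚᵘ (recip^ s m * inv s)            ∎)
  where
  open ℚᵘ.≃-Reasoning
  s = suc k
  1/_ : ℕ → ℚᵘ.ℚᵘ
  1/ d = mkℚᵘ (+ 1) (ℕ.pred d)
  s^[1+m]≡s^m*s : s ℕ.^ suc m ≡ s ℕ.^ m ℕ.* s ℕ.^ 1
  s^[1+m]≡s^m*s = trans (ℕ.*-comm s (s ℕ.^ m)) (cong (s ℕ.^ m ℕ.*_) (sym (ℕ.*-identityʳ s)))
  1/x*1/y : ∀ x y .{{_ : ℕ.NonZero x}} .{{_ : ℕ.NonZero y}} → 1/ x ℚᵘ.* 1/ y ℚᵘ.≃ 1/ (x ℕ.* y)
  1/x*1/y (suc x) (suc y) = ℚᵘ.≃-refl

recip^≡inv^ : ∀ k m → recip^ (suc k) m ≡ inv (suc k) ^ m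
recip^≡inv^ k zero          = refl
recip^≡inv^ k (suc zero)    = refl
recip^≡inv^ k (suc (suc m)) =
  trans (recip^-suc k (suc m)) (cong (_* inv (suc k)) (recip^≡inv^ k (suc m)))

sum1to-cong : ∀ n {f g : ℕ → ℚ} → (∀ i → i < n → f (suc i) ≡ g (suc i)) → sum1to n f ≡ sum1to n g
sum1to-cong zero    f≡g = refl
sum1to-cong (suc n) f≡g =
  cong₂ _+_ (sum1to-cong n (λ i i<n → f≡g i (ℕ.m<n⇒m<1+n i<n))) (f≡g n ℕ.≤-refl)

sum1to-+ : ∀ n (f g : ℕ → ℚ) → sum1to n (λ k → f k + g k) ≡ sum1to n f + sum1to n g
sum1to-+ zero    f g = refl
sum1to-+ (suc n) f g = trans (cong (_+ (f (suc n) + g (suc n))) (sum1to-+ n f g))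
  (interchange (sum1to n f) (sum1to n g) (f (suc n)) (g (suc n)))
  where
  interchange : ∀ a b c d → (a + b) + (c + d) ≡ (a + c) + (b + d)
  interchange = solve-∀ ℚ-ring

sum1to-neg : ∀ n (f : ℕ → ℚ) → sum1to n (λ k → - f k) ≡ - sum1to n f
sum1to-neg zero    f = refl
sum1to-neg (suc n) f = trans (cong (_+ - f (suc n)) (sum1to-neg n f))
  (sym (ℚ.neg-distrib-+ (sum1to n f) (f (suc n))))

sum1to-*ʳ : ∀ n (f : ℕ → ℚ) c → sum1to n (λ k → f k * c) ≡ sum1to n f * c
sum1to-*ʳ zero    f c = sym (ℚ.*-zeroˡ c)
sum1to-*ʳ (suc n) f c = trans (cong (_+ f (suc n) * c) (sum1to-*ʳ n f c))
  (sym (ℚ.*-distribʳ-+ c (sum1to n f) (f (suc n))))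

sum1to-pred : ∀ n (φ : ℕ → ℚ) → sum1to (suc n) (λ k → φ (ℕ.pred k)) ≡ φ 0 + sum1to n φ
sum1to-pred zero    φ = ℚ.+-comm 0ℚ (φ 0)
sum1to-pred (suc n) φ =
  trans (cong (_+ φ (suc n)) (sum1to-pred n φ)) (ℚ.+-assoc (φ 0) (sum1to n φ) (φ (suc n)))

Δ : (ℕ → ℚ) → ℕ → ℚ
Δ F k = F (suc k) - F k

Δ-injective : ∀ {F G : ℕ → ℚ} → F 0 ≡ G 0 → (∀ k → Δ F k ≡ Δ G k) → ∀ n → F n ≡ G n
Δ-injective             F0≡G0 ΔF≡ΔG zero    = F0≡G0
Δ-injective {F} {G} F0≡G0 ΔF≡ΔG (suc n) = begin
  F (suc n)    ≡⟨ x≡y+[x-y] (F (suc n)) (F n) ⟩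
  F n + Δ F n  ≡⟨ cong₂ _+_ (Δ-injective {F} {G} F0≡G0 ΔF≡ΔG n) (ΔF≡ΔG n) ⟩
  G n + Δ G n  ≡⟨ x≡y+[x-y] (G (suc n)) (G n) ⟨
  G (suc n)    ∎
  where
  open ≡-Reasoning
  x≡y+[x-y] : ∀ x y → x ≡ y + (x - y)
  x≡y+[x-y] = solve-∀ ℚ-ring

powerSum : ℕ → ℕ → ℚ
powerSum m n = sum1to n (λ k → inv k ^ m)

H₁ : ℕ → ℚ
H₁ = powerSum 1

H≡powerSum : ∀ n m → H n m ≡ powerSum m n
H≡powerSum zero    m = refl
H≡powerSum (suc n) m = cong₂ _+_ (H≡powerSum n m) (recip^≡inv^ n m)

-- Star sums H⋆ j n = Σ_{n ≥ m₁ ≥ ⋯ ≥ m_j ≥ 1} 1 / (m₁ ⋯ m_j); as with _^_, depth 1 is H₁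
-- on the nose rather than Σ 1 * inv m.
H⋆ : ℕ → ℕ → ℚ
H⋆ zero          n = 1ℚ
H⋆ (suc zero)    n = H₁ n
H⋆ (suc (suc j)) n = sum1to n (λ m → H⋆ (suc j) m * inv m)

ΣH₁/k² ΣH₁/k³ ΣH₂/k² ΣH₁²/k² ΣH₁H₂/k ΣH₁³/k Σ[2/k-H₁]/k² : ℕ → ℚ
ΣH₁/k² n       = sum1to n (λ k → H₁ k * inv k * inv k)
ΣH₁/k³ n       = sum1to n (λ k → H₁ k * inv k ^ 3)
ΣH₂/k² n       = sum1to n (λ k → powerSum 2 k * inv k * inv k)
ΣH₁²/k² n      = sum1to n (λ k → H₁ k ^ 2 * inv k * inv k)
ΣH₁H₂/k n      = sum1to n (λ k → H₁ k * powerSum 2 k * inv k)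
ΣH₁³/k n       = sum1to n (λ k → H₁ k ^ 3 * inv k)
Σ[2/k-H₁]/k² n = sum1to n (λ k → (2 * inv k + -1 * H₁ k) * inv k * inv k)

newton₂ : ∀ n → 2 * H⋆ 2 n ≡ H₁ n ^ 2 + powerSum 2 n
newton₂ = Δ-injective refl (λ k → step (H⋆ 2 k) (H₁ k) (powerSum 2 k) (inv (suc k)))
  where
  step : ∀ X x y t → 2 * (X + (x + t) * t) - 2 * X ≡ ((x + t) ^ 2 + (y + t ^ 2)) - (x ^ 2 + y)
  step = solve-∀ ℚ-ring

newton₃ : ∀ n → 6 * H⋆ 3 n ≡ H₁ n ^ 3 + 3 * H₁ n * powerSum 2 n + 2 * powerSum 3 n
newton₃ = Δ-injective refl (λ k → let t = inv (suc k) in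
  trans (step₁ (H⋆ 3 k) (H⋆ 2 (suc k)) t)
        (trans (cong (λ z → 3 * z * t) (newton₂ (suc k)))
               (step₂ (H₁ k) (powerSum 2 k) (powerSum 3 k) t)))
  where
  step₁ : ∀ X Y t → 6 * (X + Y * t) - 6 * X ≡ 3 * (2 * Y) * t
  step₁ = solve-∀ ℚ-ring
  step₂ : ∀ x y z t → 3 * ((x + t) ^ 2 + (y + t ^ 2)) * t ≡
            ((x + t) ^ 3 + 3 * (x + t) * (y + t ^ 2) + 2 * (z + t ^ 3)) - (x ^ 3 + 3 * x * y + 2 * z)
  step₂ = solve-∀ ℚ-ring

newton₄ : ∀ n → 24 * H⋆ 4 n ≡ H₁ n ^ 4 + 6 * H₁ n ^ 2 * powerSum 2 n + 3 * powerSum 2 n ^ 2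
                              + 8 * H₁ n * powerSum 3 n + 6 * powerSum 4 n
newton₄ = Δ-injective refl (λ k → let t = inv (suc k) in
  trans (step₁ (H⋆ 4 k) (H⋆ 3 (suc k)) t)
        (trans (cong (λ z → 4 * z * t) (newton₃ (suc k)))
               (step₂ (H₁ k) (powerSum 2 k) (powerSum 3 k) (powerSum 4 k) t)))
  where
  step₁ : ∀ X Y t → 24 * (X + Y * t) - 24 * X ≡ 4 * (6 * Y) * t
  step₁ = solve-∀ ℚ-ring
  step₂ : ∀ x y z w t → 4 * ((x + t) ^ 3 + 3 * (x + t) * (y + t ^ 2) + 2 * (z + t ^ 3)) * t ≡
            ((x + t) ^ 4 + 6 * (x + t) ^ 2 * (y + t ^ 2) + 3 * (y + t ^ 2) ^ 2
              + 8 * (x + t) * (z + t ^ 3) + 6 * (w + t ^ 4))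
            - (x ^ 4 + 6 * x ^ 2 * y + 3 * y ^ 2 + 8 * x * z + 6 * w)
  step₂ = solve-∀ ℚ-ring

H₁²-as-sum : ∀ n → H₁ n ^ 2 ≡ sum1to n (λ k → (2 * H₁ k + -1 * inv k) * inv k)
H₁²-as-sum = Δ-injective refl (λ k →
  step (H₁ k) (sum1to k (λ j → (2 * H₁ j + -1 * inv j) * inv j)) (inv (suc k)))
  where
  step : ∀ x S t → (x + t) ^ 2 - x ^ 2 ≡ (S + (2 * (x + t) + -1 * t) * t) - S
  step = solve-∀ ℚ-ring

H₂²-identity : ∀ n → powerSum 2 n ^ 2 ≡ 2 * ΣH₂/k² n - powerSum 4 n
H₂²-identity = Δ-injective refl (λ k →
  step (powerSum 2 k) (ΣH₂/k² k) (powerSum 4 k) (inv (suc k)))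
  where
  step : ∀ y U w t → (y + t ^ 2) ^ 2 - y ^ 2 ≡
           (2 * (U + (y + t ^ 2) * t * t) - (w + t ^ 4)) - (2 * U - w)
  step = solve-∀ ℚ-ring

H₁²H₂-identity : ∀ n → H₁ n ^ 2 * powerSum 2 n ≡
                   ΣH₁²/k² n + 2 * ΣH₁H₂/k n - 2 * ΣH₁/k³ n - ΣH₂/k² n + powerSum 4 n
H₁²H₂-identity = Δ-injective refl (λ k →
  step (H₁ k) (powerSum 2 k) (ΣH₁²/k² k) (ΣH₁H₂/k k) (ΣH₁/k³ k) (ΣH₂/k² k) (powerSum 4 k) (inv (suc k)))
  where
  step : ∀ x y S₁ S₂ C U w t → (x + t) ^ 2 * (y + t ^ 2) - x ^ 2 * y ≡
           ((S₁ + (x + t) ^ 2 * t * t) + 2 * (S₂ + (x + t) * (y + t ^ 2) * t)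
             - 2 * (C + (x + t) * t ^ 3) - (U + (y + t ^ 2) * t * t) + (w + t ^ 4))
           - (S₁ + 2 * S₂ - 2 * C - U + w)
  step = solve-∀ ℚ-ring

H₁⁴-identity : ∀ n → H₁ n ^ 4 ≡ 4 * ΣH₁³/k n - 6 * ΣH₁²/k² n + 4 * ΣH₁/k³ n - powerSum 4 n
H₁⁴-identity = Δ-injective refl (λ k →
  step (H₁ k) (ΣH₁³/k k) (ΣH₁²/k² k) (ΣH₁/k³ k) (powerSum 4 k) (inv (suc k)))
  where
  step : ∀ x S₃ S₁ C w t → (x + t) ^ 4 - x ^ 4 ≡
           (4 * (S₃ + (x + t) ^ 3 * t) - 6 * (S₁ + (x + t) ^ 2 * t * t)
             + 4 * (C + (x + t) * t ^ 3) - (w + t ^ 4))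
           - (4 * S₃ - 6 * S₁ + 4 * C - w)
  step = solve-∀ ℚ-ring

-- β n k = (-1)^(k-1) C(n,k) for k ≥ 1; the value β n 0 = -1 makes Pascal's rule hold at k = 0.
β : ℕ → ℕ → ℚ
β n       zero    = -1
β zero    (suc k) = 0ℚ
β (suc n) (suc k) = β n (suc k) - β n k

β-vanishes : ∀ n k → n < k → β n k ≡ 0ℚ
β-vanishes zero    (suc k)       _         = refl
β-vanishes (suc n) (suc (suc k)) (s≤s n<k) =
  cong₂ _-_ (β-vanishes n (suc (suc k)) (ℕ.m<n⇒m<1+n n<k)) (β-vanishes n (suc k) n<k)

β-1 : ∀ n → β n 1 ≡ fromℕ n
β-1 zero    = refl
β-1 (suc n) = trans (cong (_- -1) (β-1 n)) (x+1 (fromℕ n))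
  where
  x+1 : ∀ x → x - -1 ≡ 1ℚ + x
  x+1 = solve-∀ ℚ-ring

β-absorption : ∀ n k → fromℕ (suc k) * β (suc n) (suc k) ≡ - (fromℕ (suc n) * β n k)
β-absorption zero    zero    = refl
β-absorption zero    (suc k) = ℚ.*-zeroʳ (fromℕ (suc (suc k)))
β-absorption (suc n) zero    =
  trans (cong (1ℚ *_) (β-1 (suc (suc n)))) (x≡-[x*-1] (fromℕ (suc (suc n))))
  where
  x≡-[x*-1] : ∀ x → 1ℚ * x ≡ - (x * -1)
  x≡-[x*-1] = solve-∀ ℚ-ring
β-absorption (suc n) (suc k) = begin
  (1ℚ + K) * (β (suc n) (suc (suc k)) - (β n (suc k) - β n k))
    ≡⟨ expand K (β (suc n) (suc (suc k))) (β n (suc k)) (β n k) ⟩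
  (1ℚ + K) * β (suc n) (suc (suc k)) - (β n (suc k) - β n k) - K * (β n (suc k) - β n k)
    ≡⟨ cong₂ (λ u v → u - (β n (suc k) - β n k) - v) (β-absorption n (suc k)) (β-absorption n k) ⟩
  - (N * β n (suc k)) - (β n (suc k) - β n k) - - (N * β n k)
    ≡⟨ collect N (β n (suc k)) (β n k) ⟩
  - ((1ℚ + N) * (β n (suc k) - β n k)) ∎
  where
  open ≡-Reasoning
  K N : ℚ
  K = fromℕ (suc k)
  N = fromℕ (suc n)
  expand : ∀ K z x y → (1ℚ + K) * (z - (x - y)) ≡ (1ℚ + K) * z - (x - y) - K * (x - y)
  expand = solve-∀ ℚ-ring
  collect : ∀ N x y → - (N * x) - (x - y) - - (N * y) ≡ - ((1ℚ + N) * (x - y))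
  collect = solve-∀ ℚ-ring

β-absorption-inv : ∀ n k → β n k * inv (suc k) ≡ - (β (suc n) (suc k) * inv (suc n))
β-absorption-inv n k = begin
  b * u                    ≡⟨ trans (cong (b * u *_) (fromℕ*inv≡1 n)) (ℚ.*-identityʳ (b * u)) ⟨
  b * u * (N * v)          ≡⟨ regroup₁ b u N v ⟩
  - (- (N * b) * (u * v))  ≡⟨ cong (λ z → - (z * (u * v))) (β-absorption n k) ⟨
  - ((K * b′) * (u * v))   ≡⟨ regroup₂ K b′ u v ⟩
  - ((K * u) * (b′ * v))   ≡⟨ cong (λ z → - (z * (b′ * v))) (fromℕ*inv≡1 k) ⟩
  - (1ℚ * (b′ * v))        ≡⟨ cong -_ (ℚ.*-identityˡ (b′ * v)) ⟩
  - (b′ * v)               ∎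
  where
  open ≡-Reasoning
  b b′ K N u v : ℚ
  b  = β n k
  b′ = β (suc n) (suc k)
  K  = fromℕ (suc k)
  N  = fromℕ (suc n)
  u  = inv (suc k)
  v  = inv (suc n)
  regroup₁ : ∀ b u N v → b * u * (N * v) ≡ - (- (N * b) * (u * v))
  regroup₁ = solve-∀ ℚ-ring
  regroup₂ : ∀ K b′ u v → - ((K * b′) * (u * v)) ≡ - ((K * u) * (b′ * v))
  regroup₂ = solve-∀ ℚ-ring

T : ℕ → (ℕ → ℚ) → ℚ
T n f = sum1to n (λ k → β n k * f k)

T′ : ℕ → (ℕ → ℚ) → ℚ
T′ n f = sum1to (suc n) (λ k → β n (ℕ.pred k) * f k)

T-cong : ∀ n {f g : ℕ → ℚ} → (∀ i → i < n → f (suc i) ≡ g (suc i)) → T n f ≡ T n g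
T-cong n f≡g = sum1to-cong n (λ i i<n → cong (β n (suc i) *_) (f≡g i i<n))

T-linear : ∀ n c d (f g : ℕ → ℚ) → T n (λ k → c * f k + d * g k) ≡ c * T n f + d * T n g
T-linear n c d f g = begin
  sum1to n (λ k → β n k * (c * f k + d * g k))
    ≡⟨ sum1to-cong n (λ i _ → distribute (β n (suc i)) c d (f (suc i)) (g (suc i))) ⟩
  sum1to n (λ k → β n k * f k * c + β n k * g k * d)
    ≡⟨ sum1to-+ n _ _ ⟩
  sum1to n (λ k → β n k * f k * c) + sum1to n (λ k → β n k * g k * d)
    ≡⟨ cong₂ _+_ (trans (sum1to-*ʳ n _ c) (ℚ.*-comm (T n f) c))
                 (trans (sum1to-*ʳ n _ d) (ℚ.*-comm (T n g) d)) ⟩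
  c * T n f + d * T n g ∎
  where
  open ≡-Reasoning
  distribute : ∀ b c d x y → b * (c * x + d * y) ≡ b * x * c + b * y * d
  distribute = solve-∀ ℚ-ring

T-pascal : ∀ n f → T (suc n) f ≡ T n f - T′ n f
T-pascal n f = begin
  sum1to (suc n) (λ k → β (suc n) k * f k)
    ≡⟨ sum1to-cong (suc n) (λ i _ → split (β n (suc i)) (β n i) (f (suc i))) ⟩
  sum1to (suc n) (λ k → β n k * f k + - (β n (ℕ.pred k) * f k))
    ≡⟨ sum1to-+ (suc n) _ _ ⟩
  sum1to (suc n) (λ k → β n k * f k) + sum1to (suc n) (λ k → - (β n (ℕ.pred k) * f k))
    ≡⟨ cong (λ z → sum1to (suc n) (λ k → β n k * f k) + z) (sum1to-neg (suc n) _) ⟩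
  T n f + β n (suc n) * f (suc n) - T′ n f
    ≡⟨ cong (λ b → T n f + b * f (suc n) - T′ n f) (β-vanishes n (suc n) ℕ.≤-refl) ⟩
  T n f + 0ℚ * f (suc n) - T′ n f
    ≡⟨ drop-0 (T n f) (f (suc n)) (T′ n f) ⟩
  T n f - T′ n f ∎
  where
  open ≡-Reasoning
  split : ∀ x y z → (x - y) * z ≡ x * z + - (y * z)
  split = solve-∀ ℚ-ring
  drop-0 : ∀ t z e → t + 0ℚ * z - e ≡ t - e
  drop-0 = solve-∀ ℚ-ring

T-one : ∀ n → T (suc n) (λ _ → 1ℚ) ≡ 1ℚ
T-one n = begin
  T (suc n) one                  ≡⟨ T-pascal n one ⟩
  T n one - T′ n one             ≡⟨ cong (λ z → T n one - z) (sum1to-pred n (λ j → β n j * 1ℚ)) ⟩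
  T n one - (-1 * 1ℚ + T n one)  ≡⟨ cancel (T n one) ⟩
  1ℚ                             ∎
  where
  open ≡-Reasoning
  one : ℕ → ℚ
  one _ = 1ℚ
  cancel : ∀ t → t - (-1 * 1ℚ + t) ≡ 1ℚ
  cancel = solve-∀ ℚ-ring

T′-*inv : ∀ n f → T′ n (λ k → f k * inv k) ≡ - (T (suc n) f * inv (suc n))
T′-*inv n f = begin
  sum1to (suc n) (λ k → β n (ℕ.pred k) * (f k * inv k))
    ≡⟨ sum1to-cong (suc n) (λ i _ → summand i) ⟩
  sum1to (suc n) (λ k → - (β (suc n) k * f k * inv (suc n)))
    ≡⟨ trans (sum1to-neg (suc n) _) (cong -_ (sum1to-*ʳ (suc n) _ (inv (suc n)))) ⟩
  - (T (suc n) f * inv (suc n)) ∎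
  where
  open ≡-Reasoning
  swap : ∀ b x u → b * (x * u) ≡ b * u * x
  swap = solve-∀ ℚ-ring
  swap′ : ∀ b v x → - (b * v) * x ≡ - (b * x * v)
  swap′ = solve-∀ ℚ-ring
  summand : ∀ i → β n i * (f (suc i) * inv (suc i)) ≡ - (β (suc n) (suc i) * f (suc i) * inv (suc n))
  summand i = begin
    β n i * (f (suc i) * inv (suc i))                ≡⟨ swap (β n i) (f (suc i)) (inv (suc i)) ⟩
    β n i * inv (suc i) * f (suc i)                  ≡⟨ cong (_* f (suc i)) (β-absorption-inv n i) ⟩
    - (β (suc n) (suc i) * inv (suc n)) * f (suc i)  ≡⟨ swap′ (β (suc n) (suc i)) (inv (suc n)) (f (suc i)) ⟩
    - (β (suc n) (suc i) * f (suc i) * inv (suc n))  ∎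

T-*inv : ∀ n f → T n (λ k → f k * inv k) ≡ sum1to n (λ m → T m f * inv m)
T-*inv zero    f = refl
T-*inv (suc n) f = begin
  T (suc n) (λ k → f k * inv k)                         ≡⟨ T-pascal n _ ⟩
  T n (λ k → f k * inv k) - T′ n (λ k → f k * inv k)    ≡⟨ cong₂ _-_ (T-*inv n f) (T′-*inv n f) ⟩
  S - - (T (suc n) f * inv (suc n))                     ≡⟨ cong (λ z → S + z) (neg-involutive _) ⟩
  S + T (suc n) f * inv (suc n)                         ∎
  where
  open ≡-Reasoning
  S : ℚ
  S = sum1to n (λ m → T m f * inv m)

T-partialSum : ∀ n u → T (suc n) (λ k → sum1to k u) ≡ - T′ n u
T-partialSum n u = begin
  T (suc n) U                         ≡⟨ T-pascal n U ⟩
  T n U - T′ n U                      ≡⟨ cong (λ z → T n U - z) T′U ⟩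
  T n U - (-1 * 0ℚ + T n U + T′ n u)  ≡⟨ cancel (T n U) (T′ n u) ⟩
  - T′ n u                            ∎
  where
  open ≡-Reasoning
  U : ℕ → ℚ
  U k = sum1to k u
  cancel : ∀ t e → t - (-1 * 0ℚ + t + e) ≡ - e
  cancel = solve-∀ ℚ-ring
  T′U : T′ n U ≡ -1 * 0ℚ + T n U + T′ n u
  T′U = begin
    sum1to (suc n) (λ k → β n (ℕ.pred k) * U k)
      ≡⟨ sum1to-cong (suc n) (λ i _ → ℚ.*-distribˡ-+ (β n i) (U i) (u (suc i))) ⟩
    sum1to (suc n) (λ k → β n (ℕ.pred k) * U (ℕ.pred k) + β n (ℕ.pred k) * u k)
      ≡⟨ sum1to-+ (suc n) _ _ ⟩
    sum1to (suc n) (λ k → β n (ℕ.pred k) * U (ℕ.pred k)) + T′ n u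
      ≡⟨ cong (_+ T′ n u) (sum1to-pred n (λ j → β n j * U j)) ⟩
    -1 * 0ℚ + T n U + T′ n u ∎

T-partialSum-*inv : ∀ n v → T (suc n) (λ k → sum1to k (λ j → v j * inv j)) ≡ T (suc n) v * inv (suc n)
T-partialSum-*inv n v = trans (T-partialSum n _) (trans (cong -_ (T′-*inv n v)) (neg-involutive _))

T-inv : ∀ n → T (suc n) inv ≡ H₁ (suc n)
T-inv n = begin
  T (suc n) inv                                  ≡⟨ T-cong (suc n) (λ i _ → sym (ℚ.*-identityˡ (inv (suc i)))) ⟩
  T (suc n) (λ k → 1ℚ * inv k)                   ≡⟨ T-*inv (suc n) (λ _ → 1ℚ) ⟩
  sum1to (suc n) (λ m → T m (λ _ → 1ℚ) * inv m)  ≡⟨ sum1to-cong (suc n) (λ i _ → T-one-*inv i) ⟩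
  H₁ (suc n)                                     ∎
  where
  open ≡-Reasoning
  T-one-*inv : ∀ i → T (suc i) (λ _ → 1ℚ) * inv (suc i) ≡ inv (suc i)
  T-one-*inv i = trans (cong (_* inv (suc i)) (T-one i)) (ℚ.*-identityˡ (inv (suc i)))

T-inv^ : ∀ j n → T (suc n) (λ k → inv k ^ j) ≡ H⋆ j (suc n)
T-inv^ zero          n = T-one n
T-inv^ (suc zero)    n = T-inv n
T-inv^ (suc (suc j)) n = trans (T-*inv (suc n) (λ k → inv k ^ suc j))
  (sum1to-cong (suc n) (λ i _ → cong (_* inv (suc i)) (T-inv^ (suc j) i)))

T-H₁ : ∀ n → T (suc n) H₁ ≡ inv (suc n)
T-H₁ n = begin
  T (suc n) H₁
    ≡⟨ T-cong (suc n) (λ i _ → sum1to-cong (suc i) (λ j _ → sym (ℚ.*-identityˡ (inv (suc j))))) ⟩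
  T (suc n) (λ k → sum1to k (λ j → 1ℚ * inv j))
    ≡⟨ T-partialSum-*inv n (λ _ → 1ℚ) ⟩
  T (suc n) (λ _ → 1ℚ) * inv (suc n)
    ≡⟨ trans (cong (_* inv (suc n)) (T-one n)) (ℚ.*-identityˡ (inv (suc n))) ⟩
  inv (suc n) ∎
  where open ≡-Reasoning

T-H₂ : ∀ n → T (suc n) (powerSum 2) ≡ H₁ (suc n) * inv (suc n)
T-H₂ n = trans (T-partialSum-*inv n inv) (cong (_* inv (suc n)) (T-inv n))

T-H₁² : ∀ n → T (suc n) (λ k → H₁ k ^ 2) ≡ (2 * inv (suc n) + -1 * H₁ (suc n)) * inv (suc n)
T-H₁² n = begin
  T (suc n) (λ k → H₁ k ^ 2)
    ≡⟨ T-cong (suc n) (λ i _ → H₁²-as-sum (suc i)) ⟩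
  T (suc n) (λ k → sum1to k (λ j → (2 * H₁ j + -1 * inv j) * inv j))
    ≡⟨ T-partialSum-*inv n (λ j → 2 * H₁ j + -1 * inv j) ⟩
  T (suc n) (λ j → 2 * H₁ j + -1 * inv j) * inv (suc n)
    ≡⟨ cong (_* inv (suc n)) (T-linear (suc n) 2 -1 H₁ inv) ⟩
  (2 * T (suc n) H₁ + -1 * T (suc n) inv) * inv (suc n)
    ≡⟨ cong₂ (λ a b → (2 * a + -1 * b) * inv (suc n)) (T-H₁ n) (T-inv n) ⟩
  (2 * inv (suc n) + -1 * H₁ (suc n)) * inv (suc n) ∎
  where open ≡-Reasoning

T-H₂/k² : ∀ n → T n (λ k → powerSum 2 k * inv k * inv k) ≡ H₁ n * ΣH₁/k² n - ΣH₁²/k² n + ΣH₁/k³ n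
T-H₂/k² n = begin
  T n (λ k → powerSum 2 k * inv k * inv k)
    ≡⟨ T-*inv n (λ k → powerSum 2 k * inv k) ⟩
  sum1to n (λ m → T m (λ k → powerSum 2 k * inv k) * inv m)
    ≡⟨ sum1to-cong n (λ i _ → cong (_* inv (suc i)) (trans (T-*inv (suc i) (powerSum 2))
         (sum1to-cong (suc i) (λ j _ → cong (_* inv (suc j)) (T-H₂ j))))) ⟩
  sum1to n (λ m → ΣH₁/k² m * inv m)
    ≡⟨ by-parts n ⟩
  H₁ n * ΣH₁/k² n - ΣH₁²/k² n + ΣH₁/k³ n ∎
  where
  open ≡-Reasoning
  step : ∀ P A x S₁ C t → (P + (A + (x + t) * t * t) * t) - P ≡
           ((x + t) * (A + (x + t) * t * t) - (S₁ + (x + t) ^ 2 * t * t) + (C + (x + t) * t ^ 3))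
           - (x * A - S₁ + C)
  step = solve-∀ ℚ-ring
  by-parts : ∀ n → sum1to n (λ m → ΣH₁/k² m * inv m) ≡ H₁ n * ΣH₁/k² n - ΣH₁²/k² n + ΣH₁/k³ n
  by-parts = Δ-injective refl (λ k →
    step (sum1to k (λ m → ΣH₁/k² m * inv m)) (ΣH₁/k² k) (H₁ k) (ΣH₁²/k² k) (ΣH₁/k³ k) (inv (suc k)))

T-H₁²/k² : ∀ n → T n (λ k → H₁ k ^ 2 * inv k * inv k) ≡
             H₁ n * Σ[2/k-H₁]/k² n - 3 * ΣH₁/k³ n + 2 * powerSum 4 n + ΣH₁²/k² n
T-H₁²/k² n = begin
  T n (λ k → H₁ k ^ 2 * inv k * inv k)
    ≡⟨ T-*inv n (λ k → H₁ k ^ 2 * inv k) ⟩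
  sum1to n (λ m → T m (λ k → H₁ k ^ 2 * inv k) * inv m)
    ≡⟨ sum1to-cong n (λ i _ → cong (_* inv (suc i)) (trans (T-*inv (suc i) (λ k → H₁ k ^ 2))
         (sum1to-cong (suc i) (λ j _ → cong (_* inv (suc j)) (T-H₁² j))))) ⟩
  sum1to n (λ m → Σ[2/k-H₁]/k² m * inv m)
    ≡⟨ by-parts n ⟩
  H₁ n * Σ[2/k-H₁]/k² n - 3 * ΣH₁/k³ n + 2 * powerSum 4 n + ΣH₁²/k² n ∎
  where
  open ≡-Reasoning
  step : ∀ P X x C w S₁ t → (P + (X + (2 * t + -1 * (x + t)) * t * t) * t) - P ≡
           ((x + t) * (X + (2 * t + -1 * (x + t)) * t * t) - 3 * (C + (x + t) * t ^ 3)
             + 2 * (w + t ^ 4) + (S₁ + (x + t) ^ 2 * t * t))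
           - (x * X - 3 * C + 2 * w + S₁)
  step = solve-∀ ℚ-ring
  by-parts : ∀ n → sum1to n (λ m → Σ[2/k-H₁]/k² m * inv m) ≡
               H₁ n * Σ[2/k-H₁]/k² n - 3 * ΣH₁/k³ n + 2 * powerSum 4 n + ΣH₁²/k² n
  by-parts = Δ-injective refl (λ k →
    step (sum1to k (λ m → Σ[2/k-H₁]/k² m * inv m)) (Σ[2/k-H₁]/k² k) (H₁ k) (ΣH₁/k³ k)
         (powerSum 4 k) (ΣH₁²/k² k) (inv (suc k)))

module Localisation {p : ℕ} (p-prime : Prime p) where

  -- Membership of q in ℤ₍ₚ₎ and in pℤ₍ₚ₎, witnessed by any (not necessarily reduced)
  -- representative, so that the closure properties need no gcd computations.
  Integral : ℚ → Set
  Integral q = ∃[ u ] toℚᵘ q ℚᵘ.≃ u × p ∤ ℚᵘ.↧ₙ u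

  Divisible : ℚ → Set
  Divisible q = ∃[ u ] toℚᵘ q ℚᵘ.≃ u × p ∤ ℚᵘ.↧ₙ u × + p ℤ.∣ ℚᵘ.↥ u

  ∤-* : ∀ {a b} → p ∤ a → p ∤ b → p ∤ a ℕ.* b
  ∤-* {a} {b} p∤a p∤b p∣ab with euclidsLemma a b p-prime p∣ab
  ... | inj₁ p∣a = p∤a p∣a
  ... | inj₂ p∣b = p∤b p∣b

  p∤1 : p ∤ 1
  p∤1 p∣1 = ℕ.nonTrivial⇒≢1 {{prime⇒nonTrivial p-prime}} (ℕ.∣1⇒≡1 p∣1)

  p∤<p : ∀ {c} → 0 < c → c < p → p ∤ c
  p∤<p 0<c c<p p∣c = ℕ.<⇒≱ c<p (ℕ.∣⇒≤ {{ℕ.>-nonZero 0<c}} p∣c)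

  integral-+ : ∀ {x y} → Integral x → Integral y → Integral (x + y)
  integral-+ {x} {y} (u@(mkℚᵘ _ _) , x≃u , p∤u) (v@(mkℚᵘ _ _) , y≃v , p∤v) =
    u ℚᵘ.+ v , ℚᵘ.≃-trans (ℚ.toℚᵘ-homo-+ x y) (ℚᵘ.+-cong x≃u y≃v) , ∤-* p∤u p∤v

  integral-* : ∀ {x y} → Integral x → Integral y → Integral (x * y)
  integral-* {x} {y} (u@(mkℚᵘ _ _) , x≃u , p∤u) (v@(mkℚᵘ _ _) , y≃v , p∤v) =
    u ℚᵘ.* v , ℚᵘ.≃-trans (ℚ.toℚᵘ-homo-* x y) (ℚᵘ.*-cong x≃u y≃v) , ∤-* p∤u p∤v

  integral-neg : ∀ {x} → Integral x → Integral (- x)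
  integral-neg {x} (u@(mkℚᵘ _ _) , x≃u , p∤u) =
    ℚᵘ.- u , ℚᵘ.≃-trans (ℚ.toℚᵘ-homo‿- x) (ℚᵘ.-‿cong x≃u) , p∤u

  integral-fromℕ : ∀ n → Integral (fromℕ n)
  integral-fromℕ n = mkℚᵘ (+ n) 0 , toℚᵘ-fromℕ n , p∤1

  integral-fromℤ : ∀ z → Integral (ℚLiteral.fromℤ z)
  integral-fromℤ z = mkℚᵘ z 0 , ℚᵘ.≃-refl , p∤1

  integral-recip^ : ∀ k m → p ∤ suc k → Integral (recip^ (suc k) m)
  integral-recip^ k m p∤k = mkℚᵘ (+ 1) (ℕ.pred (suc k ℕ.^ m)) , toℚᵘ-recip^ k m ,
    subst (p ∤_) (sym (ℕ.suc-pred (suc k ℕ.^ m) {{ℕ.m^n≢0 (suc k) m}})) (∤-^ m)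
    where
    ∤-^ : ∀ m → p ∤ suc k ℕ.^ m
    ∤-^ zero    = p∤1
    ∤-^ (suc m) = ∤-* p∤k (∤-^ m)

  integral-^ : ∀ {x} j → Integral x → Integral (x ^ j)
  integral-^ zero          _  = integral-fromℕ 1
  integral-^ (suc zero)    ix = ix
  integral-^ (suc (suc j)) ix = integral-* (integral-^ (suc j) ix) ix

  integral-sum : ∀ n {f} → (∀ i → i < n → Integral (f (suc i))) → Integral (sum1to n f)
  integral-sum zero    _  = integral-fromℕ 0
  integral-sum (suc n) if =
    integral-+ (integral-sum n (λ i i<n → if i (ℕ.m<n⇒m<1+n i<n))) (if n ℕ.≤-refl)

  divisible-+ : ∀ {x y} → Divisible x → Divisible y → Divisible (x + y)
  divisible-+ {x} {y} (u@(mkℚᵘ _ _) , x≃u , p∤u , p∣u) (v@(mkℚᵘ _ _) , y≃v , p∤v , p∣v) =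
    u ℚᵘ.+ v , ℚᵘ.≃-trans (ℚ.toℚᵘ-homo-+ x y) (ℚᵘ.+-cong x≃u y≃v) , ∤-* p∤u p∤v ,
    ℤ.∣m∣n⇒∣m+n (ℤ.∣m⇒∣m*n _ p∣u) (ℤ.∣m⇒∣m*n _ p∣v)

  divisible-* : ∀ {x y} → Divisible x → Integral y → Divisible (x * y)
  divisible-* {x} {y} (u@(mkℚᵘ _ _) , x≃u , p∤u , p∣u) (v@(mkℚᵘ _ _) , y≃v , p∤v) =
    u ℚᵘ.* v , ℚᵘ.≃-trans (ℚ.toℚᵘ-homo-* x y) (ℚᵘ.*-cong x≃u y≃v) , ∤-* p∤u p∤v ,
    ℤ.∣m⇒∣m*n _ p∣u

  divisible-*ˡ : ∀ {x y} → Integral x → Divisible y → Divisible (x * y)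
  divisible-*ˡ {x} {y} ix dy = subst Divisible (ℚ.*-comm y x) (divisible-* dy ix)

  divisible-neg : ∀ {x} → Divisible x → Divisible (- x)
  divisible-neg {x} (u@(mkℚᵘ _ _) , x≃u , p∤u , p∣u) =
    ℚᵘ.- u , ℚᵘ.≃-trans (ℚ.toℚᵘ-homo‿- x) (ℚᵘ.-‿cong x≃u) , p∤u , ℤ.∣m⇒∣-m p∣u

  divisible-0 : Divisible 0ℚ
  divisible-0 = mkℚᵘ (+ 0) 0 , ℚᵘ.≃-refl , p∤1 , ℤ.∣ᵤ⇒∣ (p ℕ.∣0)

  divisible-p : Divisible (fromℕ p)
  divisible-p = mkℚᵘ (+ p) 0 , toℚᵘ-fromℕ p , p∤1 , ℤ.∣-refl

  divisible-sum : ∀ n {f} → (∀ i → i < n → Divisible (f (suc i))) → Divisible (sum1to n f)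
  divisible-sum zero    _  = divisible-0
  divisible-sum (suc n) df =
    divisible-+ (divisible-sum n (λ i i<n → df i (ℕ.m<n⇒m<1+n i<n))) (df n ℕ.≤-refl)

  divisible-cancel : ∀ c {x} → p ∤ c → Divisible (fromℕ c * x) → Divisible x
  divisible-cancel zero        p∤0 _   = contradiction (p ℕ.∣0) p∤0
  divisible-cancel (suc c) {x} p∤c dcx =
    subst Divisible cancel (divisible-* dcx (integral-recip^ c 1 p∤c))
    where
    reorder : ∀ a x b → a * x * b ≡ x * (a * b)
    reorder = solve-∀ ℚ-ring
    cancel : fromℕ (suc c) * x * inv (suc c) ≡ x
    cancel = trans (reorder (fromℕ (suc c)) x (inv (suc c)))
                   (trans (cong (x *_) (fromℕ*inv≡1 c)) (ℚ.*-identityʳ x))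

  divisible-solve : ∀ c {x y z} → p ∤ c → Divisible x → Divisible y → fromℕ c * z ≡ x + y → Divisible z
  divisible-solve c p∤c dx dy eq = divisible-cancel c p∤c (subst Divisible (sym eq) (divisible-+ dx dy))

  divisible⇒≡0mod : ∀ q → Divisible q → q ≡0mod p
  divisible⇒≡0mod (ℚ.mkℚ n d coprime) (u , *≡* eq , p∤u , p∣u) = p∤d , p∣n
    where
    cross : ℤ.∣ n ∣ ℕ.* ℚᵘ.↧ₙ u ≡ ℤ.∣ ℚᵘ.↥ u ∣ ℕ.* suc d
    cross = trans (sym (ℤ.abs-* n (ℚᵘ.↧ u))) (trans (cong ℤ.∣_∣ eq) (ℤ.abs-* (ℚᵘ.↥ u) (+ suc d)))
    p∤d : p ∤ suc d
    p∤d p∣d = p∤u (ℕ.∣-trans p∣d (Cop.coprime-divisor (Cop.sym (Cop.recompute coprime))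
                (subst (suc d ℕ.∣_) (sym cross) (ℕ.∣n⇒∣m*n ℤ.∣ ℚᵘ.↥ u ∣ ℕ.∣-refl))))
    p∣n : p ℕ.∣ ℤ.∣ n ∣
    p∣n with euclidsLemma ℤ.∣ n ∣ (ℚᵘ.↧ₙ u) p-prime
               (subst (p ℕ.∣_) (sym cross) (ℕ.∣m⇒∣m*n (suc d) (ℤ.∣⇒∣ᵤ p∣u)))
    ... | inj₁ p∣n  = p∣n
    ... | inj₂ p∣u′ = contradiction p∣u′ p∤u

module BinomialCongruence {m : ℕ} (p-prime : Prime (suc (suc m))) where
  open Localisation p-prime

  private
    n : ℕ
    n = suc m

  integral-β : ∀ n k → Integral (β n k)
  integral-β n       zero    = integral-fromℤ (ℤ.- + 1)
  integral-β zero    (suc k) = integral-fromℕ 0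
  integral-β (suc n) (suc k) = integral-+ (integral-β n (suc k)) (integral-neg (integral-β n k))

  integral-inv^ : ∀ j i → i < n → Integral (inv (suc i) ^ j)
  integral-inv^ j i i<n = integral-^ j (integral-recip^ i 1 (p∤<p (s≤s z≤n) (s≤s i<n)))

  -- C(p-1, k) ≡ (-1)^k, because p divides k C(p,k) = p C(p-1,k-1).
  β≡-1 : ∀ k → k < suc n → Divisible (β n k + 1ℚ)
  β≡-1 zero    _         = divisible-0
  β≡-1 (suc k) (s≤s k<n) = subst Divisible (sym (split (β n (suc k)) (β n k)))
    (divisible-+ β[p,1+k]≡0 (β≡-1 k (ℕ.m<n⇒m<1+n k<n)))
    where
    split : ∀ x y → x + 1ℚ ≡ (x - y) + (y + 1ℚ)
    split = solve-∀ ℚ-ring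
    β[p,1+k]≡0 : Divisible (β (suc n) (suc k))
    β[p,1+k]≡0 = divisible-cancel (suc k) (p∤<p (s≤s z≤n) (s≤s k<n))
      (subst Divisible (sym (β-absorption n k)) (divisible-neg (divisible-* divisible-p (integral-β n k))))

  T≡-sum : ∀ f → (∀ i → i < n → Integral (f (suc i))) → Divisible (T n f + sum1to n f)
  T≡-sum f integral-f = subst Divisible T+sum
    (divisible-sum n (λ i i<n → divisible-* (β≡-1 (suc i) (s≤s i<n)) (integral-f i i<n)))
    where
    distrib : ∀ b x → (b + 1ℚ) * x ≡ b * x + x
    distrib = solve-∀ ℚ-ring
    T+sum : sum1to n (λ k → (β n k + 1ℚ) * f k) ≡ T n f + sum1to n f
    T+sum = trans (sum1to-cong n (λ i _ → distrib (β n (suc i)) (f (suc i)))) (sum1to-+ n _ f)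

  H⋆≡-powerSum : ∀ j → Divisible (H⋆ j n + powerSum j n)
  H⋆≡-powerSum j =
    subst (λ t → Divisible (t + powerSum j n)) (T-inv^ j m) (T≡-sum _ (integral-inv^ j))

module HarmonicCongruences {m : ℕ} (p-prime : Prime (suc (suc m))) (p>5 : 5 < suc (suc m)) where
  open Localisation p-prime
  open BinomialCongruence p-prime

  private
    n : ℕ
    n = suc m

    p∤small : ∀ c → 0 < c → c < 6 → suc n ∤ c
    p∤small c 0<c c<6 = p∤<p 0<c (ℕ.<-≤-trans c<6 p>5)

    p∤2 : suc n ∤ 2
    p∤2 = p∤small 2 (s≤s z≤n) (s≤s (s≤s (s≤s z≤n)))
    p∤3 : suc n ∤ 3
    p∤3 = p∤small 3 (s≤s z≤n) (s≤s (s≤s (s≤s (s≤s z≤n))))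
    p∤5 : suc n ∤ 5
    p∤5 = p∤small 5 (s≤s z≤n) ℕ.≤-refl

    integral-inv : ∀ i → i < n → Integral (inv (suc i))
    integral-inv = integral-inv^ 1

    integral-H : ∀ j k → k ≤ n → Integral (powerSum j k)
    integral-H j k k≤n = integral-sum k (λ i i<k → integral-inv^ j i (ℕ.<-≤-trans i<k k≤n))

    integral-H₁ : Integral (H₁ n)
    integral-H₁ = integral-H 1 n ℕ.≤-refl

    integral-H₂ : Integral (powerSum 2 n)
    integral-H₂ = integral-H 2 n ℕ.≤-refl

  H₁≡0 : Divisible (H₁ n)
  H₁≡0 = divisible-cancel 2 p∤2 (subst Divisible (x+x≡2x (H₁ n)) (H⋆≡-powerSum 1))
    where
    x+x≡2x : ∀ x → x + x ≡ 2 * x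
    x+x≡2x = solve-∀ ℚ-ring

  H₂≡0 : Divisible (powerSum 2 n)
  H₂≡0 = divisible-solve 3 p∤3 (divisible-*ˡ (integral-fromℕ 2) (H⋆≡-powerSum 2))
    (divisible-neg (divisible-* H₁≡0 integral-H₁)) (begin
      3 * y                         ≡⟨ expand x y ⟩
      (x ^ 2 + y) + 2 * y - x * x   ≡⟨ cong (λ s → s + 2 * y - x * x) (newton₂ n) ⟨
      2 * H⋆ 2 n + 2 * y - x * x    ≡⟨ collect (H⋆ 2 n) x y ⟩
      2 * (H⋆ 2 n + y) + - (x * x)  ∎)
    where
    open ≡-Reasoning
    x y : ℚ
    x = H₁ n
    y = powerSum 2 n
    expand : ∀ x y → 3 * y ≡ (x ^ 2 + y) + 2 * y - x * x
    expand = solve-∀ ℚ-ring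
    collect : ∀ X x y → 2 * X + 2 * y - x * x ≡ 2 * (X + y) + - (x * x)
    collect = solve-∀ ℚ-ring

  H₄≡0 : Divisible (powerSum 4 n)
  H₄≡0 = divisible-solve 30 (∤-* (∤-* p∤2 p∤3) p∤5) (divisible-*ˡ (integral-fromℕ 24) (H⋆≡-powerSum 4))
    (divisible-neg (divisible-+ (divisible-* H₁≡0 integral-cubic) (divisible-* H₂≡0 integral-3y))) (begin
      30 * w
        ≡⟨ expand x y z w ⟩
      quartic + 24 * w - (x * cubic + y * 3y)
        ≡⟨ cong (λ s → s + 24 * w - (x * cubic + y * 3y)) (newton₄ n) ⟨
      24 * H⋆ 4 n + 24 * w - (x * cubic + y * 3y)
        ≡⟨ collect (H⋆ 4 n) x y z w ⟩
      24 * (H⋆ 4 n + w) + - (x * cubic + y * 3y) ∎)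
    where
    open ≡-Reasoning
    x y z w cubic 3y quartic : ℚ
    x = H₁ n
    y = powerSum 2 n
    z = powerSum 3 n
    w = powerSum 4 n
    cubic = x ^ 3 + 6 * x * y + 8 * z
    3y = 3 * y
    quartic = x ^ 4 + 6 * x ^ 2 * y + 3 * y ^ 2 + 8 * x * z + 6 * w
    integral-cubic : Integral cubic
    integral-cubic = integral-+ (integral-+ (integral-^ 3 integral-H₁)
                                            (integral-* (integral-* (integral-fromℕ 6) integral-H₁) integral-H₂))
                                (integral-* (integral-fromℕ 8) (integral-H 3 n ℕ.≤-refl))
    integral-3y : Integral 3y
    integral-3y = integral-* (integral-fromℕ 3) integral-H₂
    expand : ∀ x y z w → 30 * w ≡ (x ^ 4 + 6 * x ^ 2 * y + 3 * y ^ 2 + 8 * x * z + 6 * w) + 24 * w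
                                   - (x * (x ^ 3 + 6 * x * y + 8 * z) + y * (3 * y))
    expand = solve-∀ ℚ-ring
    collect : ∀ X x y z w → 24 * X + 24 * w - (x * (x ^ 3 + 6 * x * y + 8 * z) + y * (3 * y)) ≡
                            24 * (X + w) + - (x * (x ^ 3 + 6 * x * y + 8 * z) + y * (3 * y))
    collect = solve-∀ ℚ-ring

  ΣH₂/k²≡0 : Divisible (ΣH₂/k² n)
  ΣH₂/k²≡0 = divisible-solve 2 p∤2 (divisible-* H₂≡0 integral-H₂) H₄≡0 (begin
    2 * U                ≡⟨ add-sub (2 * U) w ⟩
    (2 * U - w) + w      ≡⟨ cong (_+ w) (H₂²-identity n) ⟨
    powerSum 2 n ^ 2 + w ∎)
    where
    open ≡-Reasoning
    U w : ℚ
    U = ΣH₂/k² n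
    w = powerSum 4 n
    add-sub : ∀ a b → a ≡ (a - b) + b
    add-sub = solve-∀ ℚ-ring

  ΣH₁²/k²≡ΣH₁/k³ : Divisible (ΣH₁²/k² n - ΣH₁/k³ n)
  ΣH₁²/k²≡ΣH₁/k³ = subst Divisible (sym (begin
    S₁ - C                                ≡⟨ rearrange x A S₁ C U ⟩
    x * A + U + - ((x * A - S₁ + C) + U)  ≡⟨ cong (λ t → x * A + U + - (t + U)) (T-H₂/k² n) ⟨
    x * A + U + - (T n f + U)             ∎))
    (divisible-+ (divisible-+ (divisible-* H₁≡0 integral-A) ΣH₂/k²≡0) (divisible-neg (T≡-sum f integral-f)))
    where
    open ≡-Reasoning
    x A S₁ C U : ℚ
    x = H₁ n
    A = ΣH₁/k² n
    S₁ = ΣH₁²/k² n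
    C = ΣH₁/k³ n
    U = ΣH₂/k² n
    f : ℕ → ℚ
    f k = powerSum 2 k * inv k * inv k
    integral-f : ∀ i → i < n → Integral (f (suc i))
    integral-f i i<n = integral-* (integral-* (integral-H 2 (suc i) i<n) (integral-inv i i<n)) (integral-inv i i<n)
    integral-A : Integral A
    integral-A = integral-sum n (λ i i<n →
      integral-* (integral-* (integral-H 1 (suc i) i<n) (integral-inv i i<n)) (integral-inv i i<n))
    rearrange : ∀ x A S₁ C U → S₁ - C ≡ x * A + U + - ((x * A - S₁ + C) + U)
    rearrange = solve-∀ ℚ-ring

  ΣH₁/k³≡0 : Divisible (ΣH₁/k³ n)
  ΣH₁/k³≡0 = subst Divisible (sym (begin
    C                                                ≡⟨ rearrange x X S₁ C w ⟩
    R + - ((x * X - 3 * C + 2 * w + S₁) + S₁)         ≡⟨ cong (λ t → R + - (t + S₁)) (T-H₁²/k² n) ⟨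
    R + - (T n f + S₁)                               ∎))
    (divisible-+ (divisible-+ (divisible-*ˡ (integral-fromℕ 2) ΣH₁²/k²≡ΣH₁/k³)
                              (divisible-+ (divisible-* H₁≡0 integral-X) (divisible-*ˡ (integral-fromℕ 2) H₄≡0)))
                 (divisible-neg (T≡-sum f integral-f)))
    where
    open ≡-Reasoning
    x X S₁ C w R : ℚ
    x = H₁ n
    X = Σ[2/k-H₁]/k² n
    S₁ = ΣH₁²/k² n
    C = ΣH₁/k³ n
    w = powerSum 4 n
    R = 2 * (S₁ - C) + (x * X + 2 * w)
    f : ℕ → ℚ
    f k = H₁ k ^ 2 * inv k * inv k
    integral-f : ∀ i → i < n → Integral (f (suc i))
    integral-f i i<n =
      integral-* (integral-* (integral-^ 2 (integral-H 1 (suc i) i<n)) (integral-inv i i<n)) (integral-inv i i<n)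
    integral-X : Integral X
    integral-X = integral-sum n (λ i i<n → integral-* (integral-* (integral-+
      (integral-* (integral-fromℕ 2) (integral-inv i i<n))
      (integral-* (integral-fromℤ _) (integral-H 1 (suc i) i<n))) (integral-inv i i<n)) (integral-inv i i<n))
    rearrange : ∀ x X S₁ C w → C ≡ 2 * (S₁ - C) + (x * X + 2 * w) + - ((x * X - 3 * C + 2 * w + S₁) + S₁)
    rearrange = solve-∀ ℚ-ring

  ΣH₁²/k²≡0 : Divisible (ΣH₁²/k² n)
  ΣH₁²/k²≡0 = subst Divisible (sub-add (ΣH₁²/k² n) (ΣH₁/k³ n)) (divisible-+ ΣH₁²/k²≡ΣH₁/k³ ΣH₁/k³≡0)
    where
    sub-add : ∀ a b → a - b + b ≡ a
    sub-add = solve-∀ ℚ-ring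

  ΣH₁H₂/k≡0 : Divisible (ΣH₁H₂/k n)
  ΣH₁H₂/k≡0 = divisible-solve 2 p∤2 (divisible-* (divisible-* H₁≡0 integral-H₁) integral-H₂)
    (divisible-+ (divisible-+ (divisible-+ (divisible-neg ΣH₁²/k²≡ΣH₁/k³) ΣH₁/k³≡0) ΣH₂/k²≡0) (divisible-neg H₄≡0))
    (begin
      2 * S₂                                 ≡⟨ rearrange S₁ S₂ C U w ⟩
      (S₁ + 2 * S₂ - 2 * C - U + w) + rest    ≡⟨ cong (_+ rest) (H₁²H₂-identity n) ⟨
      H₁ n ^ 2 * powerSum 2 n + rest         ∎)
    where
    open ≡-Reasoning
    S₁ S₂ C U w rest : ℚ
    S₁ = ΣH₁²/k² n
    S₂ = ΣH₁H₂/k n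
    C = ΣH₁/k³ n
    U = ΣH₂/k² n
    w = powerSum 4 n
    rest = - (S₁ - C) + C + U + - w
    rearrange : ∀ S₁ S₂ C U w → 2 * S₂ ≡ (S₁ + 2 * S₂ - 2 * C - U + w) + (- (S₁ - C) + C + U + - w)
    rearrange = solve-∀ ℚ-ring

  ΣH₁³/k≡0 : Divisible (ΣH₁³/k n)
  ΣH₁³/k≡0 = divisible-solve 4 (∤-* p∤2 p∤2)
    (divisible-* (divisible-* (divisible-* H₁≡0 integral-H₁) integral-H₁) integral-H₁)
    (divisible-+ (divisible-+ (divisible-*ˡ (integral-fromℕ 6) ΣH₁²/k²≡0)
                              (divisible-neg (divisible-*ˡ (integral-fromℕ 4) ΣH₁/k³≡0)))
                 H₄≡0)
    (begin
      4 * S₃                               ≡⟨ rearrange S₃ S₁ C w ⟩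
      (4 * S₃ - 6 * S₁ + 4 * C - w) + rest  ≡⟨ cong (_+ rest) (H₁⁴-identity n) ⟨
      H₁ n ^ 4 + rest                      ∎)
    where
    open ≡-Reasoning
    S₃ S₁ C w rest : ℚ
    S₃ = ΣH₁³/k n
    S₁ = ΣH₁²/k² n
    C = ΣH₁/k³ n
    w = powerSum 4 n
    rest = 6 * S₁ + - (4 * C) + w
    rearrange : ∀ S₃ S₁ C w → 4 * S₃ ≡ (4 * S₃ - 6 * S₁ + 4 * C - w) + (6 * S₁ + - (4 * C) + w)
    rearrange = solve-∀ ℚ-ring

lemma2p9 : (p : ℕ) → Prime p → p ≥ 7 →
    (sum1to (p ∸ 1) (λ k → H k 1 * H k 1 * recip^ k 2) ≡0mod p)
    × (sum1to (p ∸ 1) (λ k → H k 1 * H k 2 * recip^ k 1) ≡0mod p)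
    × (sum1to (p ∸ 1) (λ k → H k 1 * H k 1 * H k 1 * recip^ k 1) ≡0mod p)
lemma2p9 zero          _       ()
lemma2p9 (suc zero)    _       (s≤s ())
lemma2p9 (suc (suc m)) p-prime p≥7 =
    divisible⇒≡0mod _ (subst Divisible (sym (sum1to-cong n (λ i _ → first i))) ΣH₁²/k²≡0)
  , divisible⇒≡0mod _ (subst Divisible (sym (sum1to-cong n (λ i _ → second i))) ΣH₁H₂/k≡0)
  , divisible⇒≡0mod _ (subst Divisible (sym (sum1to-cong n (λ i _ → third i))) ΣH₁³/k≡0)
  where
  open Localisation p-prime
  open HarmonicCongruences p-prime (ℕ.<⇒≤ p≥7)
  n : ℕ
  n = suc m
  first : ∀ i → H (suc i) 1 * H (suc i) 1 * recip^ (suc i) 2 ≡ H₁ (suc i) ^ 2 * inv (suc i) * inv (suc i)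
  first i = trans (cong₂ (λ x t → x * x * t) (H≡powerSum (suc i) 1) (recip^≡inv^ i 2))
                  (sym (ℚ.*-assoc (H₁ (suc i) ^ 2) (inv (suc i)) (inv (suc i))))
  second : ∀ i → H (suc i) 1 * H (suc i) 2 * recip^ (suc i) 1 ≡ H₁ (suc i) * powerSum 2 (suc i) * inv (suc i)
  second i = cong₂ (λ x y → x * y * inv (suc i)) (H≡powerSum (suc i) 1) (H≡powerSum (suc i) 2)
  third : ∀ i → H (suc i) 1 * H (suc i) 1 * H (suc i) 1 * recip^ (suc i) 1 ≡ H₁ (suc i) ^ 3 * inv (suc i)
  third i = cong (λ x → x * x * x * inv (suc i)) (H≡powerSum (suc i) 1)
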